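{- Let $p\equiv 7\pmod 8$ be a prime and suppose that $1+\sqrt2$ generates the group $\mathbb{Z}_p^*/\{1,-1\}$, where $\sqrt2$ denotes a square root of $2$ in $\mathbb{Z}_p$. Then for nonzero $\alpha,\beta\in\mathbb{Z}_p$, an APS$(p,\alpha,\beta)$ exists if and only if $2\alpha^2-\beta^2\equiv 0\pmod p$.
   Context: $\mathbb{Z}_p^*$ is the multiplicative group of nonzero integers modulo $p$ (since $p\equiv 7\pmod 8$, $2$ is a square mod $p$). For an abelian group $(G,+)$ of order $v\equiv 3\pmod 4$ and nonzero $\alpha,\beta\in G$, an APS$(G,\alpha,\beta)$ is a set $\mathcal S$ of $(v-3)/4$ unordered pairs $\{x,y\}$ from $G$ with $\bigcup_{\{x,y\}\in\mathcal S}\pm\{x,y\}=G\setminus\{0,\pm\alpha\}$ and $\bigcup_{\{x,y\}\in\mathcal S}\pm\{x-y,x+y\}=G\setminus\{0,\pm\beta\}$; for $G=\mathbb{Z}_v$ written APS$(v,\alpha,\beta)$. -}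

module Defs where

open import Data.Nat using (ℕ; zero; suc; _+_; _*_; _∸_; _^_; _<_; NonZero)
open import Data.Nat.DivMod using (_%_; _/_)
open import Data.Product using (Σ; _×_; _,_; ∃-syntax)
open import Data.Sum using (_⊎_)
open import Data.List using (List; length)
open import Data.List.Relation.Unary.All using (All)
open import Data.List.Relation.Unary.Any using (Any)
open import Relation.Binary.PropositionalEquality using (_≡_; _≢_)
open import Function.Bundles using (_⇔_)

-- Elements of ℤ_v are represented by their canonical representatives 0 ≤ x < v.
module _ (v : ℕ) .{{_ : NonZero v}} where

  negᵥ : ℕ → ℕ
  negᵥ x = (v ∸ (x % v)) % v

  addᵥ : ℕ → ℕ → ℕ
  addᵥ x y = (x + y) % v

  subᵥ : ℕ → ℕ → ℕ
  subᵥ x y = (x + negᵥ y) % v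

  InPM : ℕ → ℕ → ℕ → Set
  InPM z a b = z ≡ a ⊎ z ≡ negᵥ a ⊎ z ≡ b ⊎ z ≡ negᵥ b

  CoversElem : ℕ → ℕ × ℕ → Set
  CoversElem z (x , y) = InPM z x y

  CoversDiffSum : ℕ → ℕ × ℕ → Set
  CoversDiffSum z (x , y) = InPM z (subᵥ x y) (addᵥ x y)

  NotIn0PM : ℕ → ℕ → Set
  NotIn0PM α z = z ≢ 0 × z ≢ α × z ≢ negᵥ α

  InZv : ℕ × ℕ → Set
  InZv (x , y) = x < v × y < v

  -- APS(v, α, β): a collection S of (v-3)/4 unordered pairs {x,y} of elements
  -- of ℤ_v (each unordered pair given by one of its orderings; both defining
  -- conditions are invariant under swapping x and y) such that
  --   ⋃ ±{x,y}      = ℤ_v ∖ {0, ±α}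
  --   ⋃ ±{x-y, x+y} = ℤ_v ∖ {0, ±β}
  APS : ℕ → ℕ → Set
  APS α β =
    Σ (List (ℕ × ℕ)) λ S →
      length S ≡ (v ∸ 3) / 4
      × All InZv S
      × (∀ z → z < v → (Any (CoversElem z) S ⇔ NotIn0PM α z))
      × (∀ z → z < v → (Any (CoversDiffSum z) S ⇔ NotIn0PM β z))

  GeneratesModSign : ℕ → Set
  GeneratesModSign g =
    ∀ x → x < v → x ≢ 0 → ∃[ k ] ((g ^ k) % v ≡ x ⊎ (g ^ k) % v ≡ negᵥ x)

-- Let ω = 1 + √2. As ω(√2 − 1) = 1 and ω generates ℤ_p^*/{±1}, a pigeonhole argument shows
-- that ω has order exactly m = (p − 1)/2 in that group; hence for every nonzero γ the classes
-- ±γω^e with 0 < e < m are exactly the nonzero classes other than ±γ.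
-- Sufficiency: for p = 4k + 3 take the k pairs (αω^(2j+1), αω^(2j+2)). Their entries run through
-- αω^e with 0 < e < m, and since 1 − ω = −√2 and 1 + ω = √2·ω, their differences and sums run
-- through ±α√2·ω^e, which avoid exactly ±α√2 = ±β.
-- Necessity: the covering condition makes 0, ±α and the entries ±x, ±y of the pairs a permutation
-- of ℤ_p, and Σ_{z∈ℤ_p} z² ≡ 0 for p > 3, so Σ(x² + y²) ≡ −α². Likewise
-- Σ((x − y)² + (x + y)²) ≡ −β², but the left-hand side is 2Σ(x² + y²); hence β² ≡ 2α².

module Submission where

open import Data.Empty using (⊥)
open import Data.Fin.Base as Fin using (Fin; toℕ; fromℕ<)
import Data.Fin.Properties as Fin
open import Data.Integer.Base using (ℤ; +_; -_; -[1+_]; ∣_∣; 0ℤ; 1ℤ)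
import Data.Integer.Properties as ℤ
open import Data.Integer.Divisibility.Signed
  using (_∣_; divides; ∣⇒∣ᵤ; ∣ᵤ⇒∣; ∣m∣n⇒∣m+n; ∣m⇒∣-m; ∣n⇒∣m*n)
open import Data.Integer.Tactic.RingSolver using (solve-∀)
open import Data.List.Base using (List; []; _∷_; _++_; length; map; foldr; applyUpTo; downFrom)
open import Data.List.Properties using (length-applyUpTo; length-map; length-downFrom)
open import Data.List.Membership.Propositional using (_∈_)
open import Data.List.Membership.Propositional.Properties
  using (∈-∃++; ∈-++⁻; ∈-++⁺ˡ; ∈-++⁺ʳ; ∈-downFrom⁻)
open import Data.List.Relation.Unary.Any using (Any; here; there)
import Data.List.Relation.Unary.Any.Properties as Any
import Data.List.Relation.Unary.All as All
import Data.List.Relation.Unary.All.Properties as All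
open import Data.List.Relation.Unary.AllPairs using (_∷_)
open import Data.List.Relation.Unary.Unique.Propositional using (Unique)
open import Data.List.Relation.Unary.Unique.Propositional.Properties using (downFrom⁺)
open import Data.List.Relation.Binary.Permutation.Propositional
  using (_↭_; ↭-refl; ↭-prep; ↭-trans; ↭⇒↭ₛ)
open import Data.List.Relation.Binary.Permutation.Propositional.Properties
  using (shift; ↭-length; map⁺)
import Data.List.Relation.Binary.Permutation.Setoid.Properties as Permutationₛ
open import Data.Nat.Base as ℕ using (ℕ; zero; suc; NonZero; _<_; _≤_; _∸_; _⊓_; z≤n; s≤s)
import Data.Nat.Properties as ℕ
import Data.Nat.Divisibility as ℕ
open import Data.Nat.DivMod using (_%_; _/_; m≡m%n+[m/n]*n; m%n<n; m*n/n≡m)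
open import Data.Nat.Primality using (Prime; euclidsLemma; prime⇒nonTrivial)
import Data.Nat.Tactic.RingSolver as ℕ
open import Data.Product using (_×_; _,_; proj₁; proj₂; ∃-syntax; ∃₂)
open import Data.Sum as Sum using (_⊎_; inj₁; inj₂)
open import Data.Sum.Function.Propositional using (_⊎-⇔_)
open import Function.Base using (_∘_)
open import Function.Bundles using (_⇔_; mk⇔; Equivalence)
import Function.Properties.Equivalence as ⇔
open import Level using (0ℓ)
open import Relation.Binary.Bundles using (Setoid)
open import Relation.Binary.Definitions using (tri<; tri≈; tri>)
open import Relation.Binary.PropositionalEquality
  using (_≡_; _≢_; refl; sym; trans; cong; subst; setoid; module ≡-Reasoning)
import Relation.Binary.Reasoning.Setoid as SetoidReasoning
open import Relation.Nullary using (¬_; contradiction; yes; no)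

open import Defs

parity : ∀ n → ∃[ j ] (n ≡ 2 ℕ.* j ⊎ n ≡ suc (2 ℕ.* j))
parity zero = 0 , inj₁ refl
parity (suc n) with parity n
... | j , inj₁ refl = j , inj₂ refl
... | j , inj₂ refl = suc j , inj₁ (cong suc (sym (ℕ.+-suc j (j ℕ.+ 0))))

nonzero-below-odd⇔pairs : ∀ {P : ℕ → Set} k →
  (∃[ e ] 0 < e × e < suc (2 ℕ.* k) × P e) ⇔
  (∃[ j ] j < k × (P (suc (2 ℕ.* j)) ⊎ P (suc (suc (2 ℕ.* j)))))
nonzero-below-odd⇔pairs {P} k = mk⇔ to from
  where
    halve-< : ∀ {j} → 2 ℕ.* j < 2 ℕ.* k → j < k
    halve-< = ℕ.*-cancelˡ-< 2 _ _

    to : ∃[ e ] 0 < e × e < suc (2 ℕ.* k) × P e → ∃[ j ] j < k × (P (suc (2 ℕ.* j)) ⊎ P (suc (suc (2 ℕ.* j))))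
    to (suc e , _ , e<2k , Pe) with parity e
    ... | j , inj₁ refl = j , halve-< (ℕ.<-pred e<2k) , inj₁ Pe
    ... | j , inj₂ refl = j , halve-< (ℕ.<-trans (ℕ.n<1+n _) (ℕ.<-pred e<2k)) , inj₂ Pe

    from : ∃[ j ] j < k × (P (suc (2 ℕ.* j)) ⊎ P (suc (suc (2 ℕ.* j)))) → ∃[ e ] 0 < e × e < suc (2 ℕ.* k) × P e
    from (j , j<k , inj₁ P[1+2j]) = suc (2 ℕ.* j) , s≤s z≤n , s≤s (ℕ.*-monoʳ-< 2 j<k) , P[1+2j]
    from (j , j<k , inj₂ P[2+2j]) = suc (suc (2 ℕ.* j)) , s≤s z≤n , s≤s 2+2j≤2k , P[2+2j]
      where 2+2j≤2k : suc (suc (2 ℕ.* j)) ≤ 2 ℕ.* k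
            2+2j≤2k = subst (_≤ 2 ℕ.* k) (cong suc (ℕ.+-suc j (j ℕ.+ 0))) (ℕ.*-monoʳ-≤ 2 j<k)

Any-applyUpTo⇔ : ∀ {A : Set} {P : A → Set} (f : ℕ → A) n →
  Any P (applyUpTo f n) ⇔ (∃[ i ] i < n × P (f i))
Any-applyUpTo⇔ f n = mk⇔ (Any.applyUpTo⁻ f) (λ (i , i<n , Pfi) → Any.applyUpTo⁺ f Pfi i<n)

[p∸3]/4≡k : ∀ {p k} → p ≡ 3 ℕ.+ 4 ℕ.* k → (p ∸ 3) / 4 ≡ k
[p∸3]/4≡k {k = k} refl = trans (cong (_/ 4) (ℕ.*-comm 4 k)) (m*n/n≡m k 4)

⊆-shorter⇒↭ : ∀ {A : Set} {xs ys : List A} → Unique xs → (∀ {z} → z ∈ xs → z ∈ ys) →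
  length ys ≤ length xs → ys ↭ xs
⊆-shorter⇒↭ {xs = []} {ys = []}    _ _ _  = ↭-refl
⊆-shorter⇒↭ {xs = []} {ys = _ ∷ _} _ _ ()
⊆-shorter⇒↭ {xs = x ∷ xs} (x∉xs ∷ unique) xs⊆ys ys≤xs
  with as , bs , refl ← ∈-∃++ (xs⊆ys (here refl)) =
  ↭-trans (shift x as bs) (↭-prep x (⊆-shorter⇒↭ unique xs⊆as++bs shorter))
  where
    xs⊆as++bs : ∀ {z} → z ∈ xs → z ∈ as ++ bs
    xs⊆as++bs z∈xs with ∈-++⁻ as (xs⊆ys (there z∈xs))
    ... | inj₁ z∈as         = ∈-++⁺ˡ z∈as
    ... | inj₂ (here z≡x)   = contradiction (sym z≡x) (All.lookup x∉xs z∈xs)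
    ... | inj₂ (there z∈bs) = ∈-++⁺ʳ as z∈bs
    shorter : length (as ++ bs) ≤ length xs
    shorter = ℕ.≤-pred (subst (_≤ suc (length xs)) (↭-length (shift x as bs)) ys≤xs)

≡7-mod-8⇒≡3+4k : ∀ {p} → p % 8 ≡ 7 → p ≡ 3 ℕ.+ 4 ℕ.* suc (2 ℕ.* (p / 8))
≡7-mod-8⇒≡3+4k {p} p%8≡7 =
  trans (m≡m%n+[m/n]*n p 8) (trans (cong (λ r → r ℕ.+ p / 8 ℕ.* 8) p%8≡7) (identity (p / 8)))
  where identity : ∀ q → 7 ℕ.+ q ℕ.* 8 ≡ 3 ℕ.+ 4 ℕ.* suc (2 ℕ.* q)
        identity = ℕ.solve-∀

module Congruence (n : ℕ) where
  open import Data.Integer.Base using (_+_; _-_; _*_; _^_)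

  infix 4 _≈_ _≉_ _≈±_

  record _≈_ (a b : ℤ) : Set where
    constructor mk≈
    field divides-difference : + n ∣ a - b

  _≉_ : ℤ → ℤ → Set
  a ≉ b = ¬ a ≈ b

  ≈-by : ∀ {a b c} → c ≡ a - b → + n ∣ c → a ≈ b
  ≈-by refl n∣c = mk≈ n∣c

  ≈-reflexive : ∀ {a b} → a ≡ b → a ≈ b
  ≈-reflexive {a} refl = ≈-by (sym (ℤ.+-inverseʳ a)) (divides 0ℤ refl)

  ≈-refl : ∀ {a} → a ≈ a
  ≈-refl = ≈-reflexive refl

  ≈-sym : ∀ {a b} → a ≈ b → b ≈ a
  ≈-sym {a} {b} (mk≈ d) = ≈-by (identity a b) (∣m⇒∣-m d)
    where identity : ∀ a b → - (a - b) ≡ b - a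
          identity = solve-∀

  ≈-trans : ∀ {a b c} → a ≈ b → b ≈ c → a ≈ c
  ≈-trans {a} {b} {c} (mk≈ d) (mk≈ e) = ≈-by (identity a b c) (∣m∣n⇒∣m+n d e)
    where identity : ∀ a b c → (a - b) + (b - c) ≡ a - c
          identity = solve-∀

  ≈-setoid : Setoid _ _
  ≈-setoid = record
    { Carrier       = ℤ
    ; _≈_           = _≈_
    ; isEquivalence = record { refl = ≈-refl ; sym = ≈-sym ; trans = ≈-trans }
    }

  +-cong : ∀ {a b c d} → a ≈ b → c ≈ d → a + c ≈ b + d
  +-cong {a} {b} {c} {d} (mk≈ x) (mk≈ y) = ≈-by (identity a b c d) (∣m∣n⇒∣m+n x y)
    where identity : ∀ a b c d → (a - b) + (c - d) ≡ (a + c) - (b + d)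
          identity = solve-∀

  *-cong : ∀ {a b c d} → a ≈ b → c ≈ d → a * c ≈ b * d
  *-cong {a} {b} {c} {d} (mk≈ x) (mk≈ y) =
    ≈-by (identity a b c d) (∣m∣n⇒∣m+n (∣n⇒∣m*n c x) (∣n⇒∣m*n b y))
    where identity : ∀ a b c d → c * (a - b) + b * (c - d) ≡ a * c - b * d
          identity = solve-∀

  -‿cong : ∀ {a b} → a ≈ b → - a ≈ - b
  -‿cong {a} {b} (mk≈ x) = ≈-by (identity a b) (∣m⇒∣-m x)
    where identity : ∀ a b → - (a - b) ≡ - a - - b
          identity = solve-∀

  ≈0⇒∣ : ∀ {a} → a ≈ 0ℤ → + n ∣ a
  ≈0⇒∣ {a} (mk≈ d) = subst (+ n ∣_) (ℤ.+-identityʳ a) d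

  ∣⇒≈0 : ∀ {a} → + n ∣ a → a ≈ 0ℤ
  ∣⇒≈0 {a} = ≈-by (sym (ℤ.+-identityʳ a))

  ≈⇒-≈0 : ∀ {a b} → a ≈ b → a - b ≈ 0ℤ
  ≈⇒-≈0 (mk≈ d) = ∣⇒≈0 d

  -≈0⇒≈ : ∀ {a b} → a - b ≈ 0ℤ → a ≈ b
  -≈0⇒≈ a-b≈0 = mk≈ (≈0⇒∣ a-b≈0)

  n≈0 : + n ≈ 0ℤ
  n≈0 = ≈-by (sym (ℤ.+-identityʳ (+ n))) (divides 1ℤ (sym (ℤ.*-identityˡ (+ n))))

  pos-∸ : ∀ {a b} → b ≤ a → + (a ∸ b) ≡ + a - + b
  pos-∸ {a} {b} b≤a = trans (sym (ℤ.⊖-≥ b≤a)) (sym (ℤ.m-n≡m⊖n a b))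

  pos-^ : ∀ a e → + (a ℕ.^ e) ≡ (+ a) ^ e
  pos-^ a zero    = refl
  pos-^ a (suc e) = trans (ℤ.pos-* a (a ℕ.^ e)) (cong (λ t → + a * t) (pos-^ a e))

  n∸-≈-neg : ∀ {z} → z ≤ n → + (n ∸ z) ≈ - + z
  n∸-≈-neg {z} z≤ = ≈-trans (≈-reflexive (pos-∸ z≤))
    (≈-trans (+-cong n≈0 (≈-refl { - + z})) (≈-reflexive (ℤ.+-identityˡ (- + z))))

  ∤-between-0-and-n : ∀ {d} → 0 < d → d < n → ¬ (+ n ∣ + d)
  ∤-between-0-and-n {suc d} _ d<n n∣d = ℕ.<⇒≱ d<n (ℕ.∣⇒≤ (∣⇒∣ᵤ n∣d))

  ≉-between-0-and-n : ∀ {d} → 0 < d → d < n → + d ≉ 0ℤ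
  ≉-between-0-and-n 0<d d<n d≈0 = ∤-between-0-and-n 0<d d<n (≈0⇒∣ d≈0)

  <⇒≉ : ∀ {x y} → x < y → y < n → + x ≉ + y
  <⇒≉ {x} {y} x<y y<n (mk≈ d) =
    ∤-between-0-and-n (ℕ.m<n⇒0<n∸m x<y) (ℕ.≤-<-trans (ℕ.m∸n≤m y x) y<n)
      (subst (+ n ∣_) (ℤ.neg-involutive _) (∣m⇒∣-m (subst (+ n ∣_) x-y≡-[y∸x] d)))
    where x-y≡-[y∸x] : + x - + y ≡ - + (y ∸ x)
          x-y≡-[y∸x] = trans (ℤ.m-n≡m⊖n x y) (ℤ.⊖-< x<y)

  ≈⇒≡ : ∀ {x y} → x < n → y < n → + x ≈ + y → x ≡ y
  ≈⇒≡ {x} {y} x<n y<n x≈y with ℕ.<-cmp x y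
  ... | tri< x<y _ _ = contradiction x≈y (<⇒≉ x<y y<n)
  ... | tri≈ _ x≡y _ = x≡y
  ... | tri> _ _ y<x = contradiction (≈-sym x≈y) (<⇒≉ y<x x<n)

  _≈±_ : ℤ → ℤ → Set
  a ≈± b = a ≈ b ⊎ a ≈ - b

  ≈⇒≈± : ∀ {a b} → a ≈ b → a ≈± b
  ≈⇒≈± = inj₁

  ≈-neg⇒≈± : ∀ {a b} → a ≈ - b → a ≈± b
  ≈-neg⇒≈± = inj₂

  ≈-neg-flip : ∀ {a b} → a ≈ - b → - a ≈ b
  ≈-neg-flip {b = b} a≈-b = ≈-trans (-‿cong a≈-b) (≈-reflexive (ℤ.neg-involutive b))

  ≈±-refl : ∀ {a} → a ≈± a
  ≈±-refl = inj₁ ≈-refl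

  ≈±-sym : ∀ {a b} → a ≈± b → b ≈± a
  ≈±-sym (inj₁ a≈b)  = inj₁ (≈-sym a≈b)
  ≈±-sym (inj₂ a≈-b) = inj₂ (≈-sym (≈-neg-flip a≈-b))

  ≈±-trans : ∀ {a b c} → a ≈± b → b ≈± c → a ≈± c
  ≈±-trans (inj₁ a≈b)  (inj₁ b≈c)  = inj₁ (≈-trans a≈b b≈c)
  ≈±-trans (inj₁ a≈b)  (inj₂ b≈-c) = inj₂ (≈-trans a≈b b≈-c)
  ≈±-trans (inj₂ a≈-b) (inj₁ b≈c)  = inj₂ (≈-trans a≈-b (-‿cong b≈c))
  ≈±-trans (inj₂ a≈-b) (inj₂ b≈-c) = inj₁ (≈-trans a≈-b (≈-neg-flip b≈-c))

  ≈±-setoid : Setoid _ _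
  ≈±-setoid = record
    { Carrier       = ℤ
    ; _≈_           = _≈±_
    ; isEquivalence = record { refl = ≈±-refl ; sym = ≈±-sym ; trans = ≈±-trans }
    }

  ≈±-respʳ : ∀ {a b c} → b ≈± c → (a ≈± b) ⇔ (a ≈± c)
  ≈±-respʳ b≈±c = mk⇔ (λ a≈±b → ≈±-trans a≈±b b≈±c) (λ a≈±c → ≈±-trans a≈±c (≈±-sym b≈±c))

  neg-*-neg : ∀ a b → - a * - b ≡ a * b
  neg-*-neg = solve-∀

  ≈±-*-cong : ∀ {a b c d} → a ≈± b → c ≈± d → a * c ≈± b * d
  ≈±-*-cong (inj₁ a≈b) (inj₁ c≈d) = inj₁ (*-cong a≈b c≈d)
  ≈±-*-cong {b = b} {d = d} (inj₁ a≈b) (inj₂ c≈-d) =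
    inj₂ (≈-trans (*-cong a≈b c≈-d) (≈-reflexive (sym (ℤ.neg-distribʳ-* b d))))
  ≈±-*-cong {b = b} {d = d} (inj₂ a≈-b) (inj₁ c≈d) =
    inj₂ (≈-trans (*-cong a≈-b c≈d) (≈-reflexive (sym (ℤ.neg-distribˡ-* b d))))
  ≈±-*-cong {b = b} {d = d} (inj₂ a≈-b) (inj₂ c≈-d) =
    inj₁ (≈-trans (*-cong a≈-b c≈-d) (≈-reflexive (neg-*-neg b d)))

  ^-multiple-≈±1 : ∀ {x k} → x ^ k ≈± 1ℤ → ∀ q → x ^ (q ℕ.* k) ≈± 1ℤ
  ^-multiple-≈±1 xᵏ≈±1 zero    = ≈±-refl
  ^-multiple-≈±1 {x} {k} xᵏ≈±1 (suc q) = begin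
    x ^ (k ℕ.+ q ℕ.* k)   ≡⟨ ℤ.^-distribˡ-+-* x k (q ℕ.* k) ⟩
    x ^ k * x ^ (q ℕ.* k) ≈⟨ ≈±-*-cong xᵏ≈±1 (^-multiple-≈±1 xᵏ≈±1 q) ⟩
    1ℤ * 1ℤ               ≡⟨⟩
    1ℤ                    ∎
    where open SetoidReasoning ≈±-setoid

  ^-≈±-^-% : ∀ {x} k .{{_ : NonZero k}} → x ^ k ≈± 1ℤ → ∀ e → x ^ e ≈± x ^ (e % k)
  ^-≈±-^-% {x} k xᵏ≈±1 e = begin
    x ^ e                                ≡⟨ cong (x ^_) (m≡m%n+[m/n]*n e k) ⟩
    x ^ (e % k ℕ.+ (e / k) ℕ.* k)        ≡⟨ ℤ.^-distribˡ-+-* x (e % k) ((e / k) ℕ.* k) ⟩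
    x ^ (e % k) * x ^ ((e / k) ℕ.* k)    ≈⟨ ≈±-*-cong (≈±-refl {x ^ (e % k)}) (^-multiple-≈±1 xᵏ≈±1 (e / k)) ⟩
    x ^ (e % k) * 1ℤ                     ≡⟨ ℤ.*-identityʳ (x ^ (e % k)) ⟩
    x ^ (e % k)                          ∎
    where open SetoidReasoning ≈±-setoid

  ≈±-0⇒≈0 : ∀ {a} → a ≈± 0ℤ → a ≈ 0ℤ
  ≈±-0⇒≈0 (inj₁ a≈0) = a≈0
  ≈±-0⇒≈0 (inj₂ a≈0) = a≈0

  abs-≈± : ∀ a → + ∣ a ∣ ≈± a
  abs-≈± (+ k)      = ≈±-refl
  abs-≈± -[1+ k ]   = ≈-neg⇒≈± ≈-refl

  module _ .{{_ : NonZero n}} where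
    open SetoidReasoning ≈-setoid

    %-≈ : ∀ x → + (x % n) ≈ + x
    %-≈ x = ≈-by (trans (identity (+ (x % n)) q (+ n)) (cong (λ t → + (x % n) - t) (sym x≡r+qn)))
                 (divides (- q) refl)
      where
        q = + (x / n)
        x≡r+qn : + x ≡ + (x % n) + q * + n
        x≡r+qn = trans (cong +_ (m≡m%n+[m/n]*n x n))
                   (trans (ℤ.pos-+ (x % n) (x / n ℕ.* n)) (cong (λ t → + (x % n) + t) (ℤ.pos-* (x / n) n)))
        identity : ∀ r q m → - q * m ≡ r - (r + q * m)
        identity = solve-∀

    %≡⇔≈ : ∀ x y → x % n ≡ y % n ⇔ + x ≈ + y
    %≡⇔≈ x y = mk⇔ to (λ x≈y → ≈⇒≡ (m%n<n x n) (m%n<n y n) (begin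
        + (x % n) ≈⟨ %-≈ x ⟩
        + x       ≈⟨ x≈y ⟩
        + y       ≈⟨ %-≈ y ⟨
        + (y % n) ∎))
      where
        to : x % n ≡ y % n → + x ≈ + y
        to eq = begin
          + x       ≈⟨ %-≈ x ⟨
          + (x % n) ≡⟨ cong +_ eq ⟩
          + (y % n) ≈⟨ %-≈ y ⟩
          + y       ∎

    negᵥ-≈ : ∀ x → + negᵥ n x ≈ - + x
    negᵥ-≈ x = begin
      + negᵥ n x     ≈⟨ %-≈ (n ∸ x % n) ⟩
      + (n ∸ x % n)  ≈⟨ n∸-≈-neg (ℕ.<⇒≤ (m%n<n x n)) ⟩
      - + (x % n)    ≈⟨ -‿cong (%-≈ x) ⟩
      - + x          ∎

    addᵥ-≈ : ∀ x y → + addᵥ n x y ≈ + x + + y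
    addᵥ-≈ x y = ≈-trans (%-≈ (x ℕ.+ y)) (≈-reflexive (ℤ.pos-+ x y))

    subᵥ-≈ : ∀ x y → + subᵥ n x y ≈ + x - + y
    subᵥ-≈ x y = ≈-trans (addᵥ-≈ x (negᵥ n y)) (+-cong (≈-refl {+ x}) (negᵥ-≈ y))

    ≡∨≡negᵥ⇔≈± : ∀ {z a} → z < n → a < n → (z ≡ a ⊎ z ≡ negᵥ n a) ⇔ + z ≈± + a
    ≡∨≡negᵥ⇔≈± {z} {a} z<n a<n = mk⇔ to from
      where
        to : z ≡ a ⊎ z ≡ negᵥ n a → + z ≈± + a
        to (inj₁ refl) = ≈⇒≈± ≈-refl
        to (inj₂ refl) = ≈-neg⇒≈± (negᵥ-≈ a)
        from : + z ≈± + a → z ≡ a ⊎ z ≡ negᵥ n a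
        from (inj₁ z≈a)  = inj₁ (≈⇒≡ z<n a<n z≈a)
        from (inj₂ z≈-a) = inj₂ (≈⇒≡ z<n (m%n<n _ n) (≈-trans z≈-a (≈-sym (negᵥ-≈ a))))

    InPM⇔ : ∀ {z a b} → z < n → a < n → b < n → InPM n z a b ⇔ (+ z ≈± + a ⊎ + z ≈± + b)
    InPM⇔ z<n a<n b<n = mk⇔ (Sum.map A.to B.to ∘ Sum.assocˡ) (Sum.assocʳ ∘ Sum.map A.from B.from)
      where
        module A = Equivalence (≡∨≡negᵥ⇔≈± z<n a<n)
        module B = Equivalence (≡∨≡negᵥ⇔≈± z<n b<n)

    NotIn0PM⇔ : ∀ {z a} → z < n → a < n → NotIn0PM n a z ⇔ (z ≢ 0 × ¬ (+ z ≈± + a))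
    NotIn0PM⇔ z<n a<n =
      mk⇔ (λ (z≢0 , z≢a , z≢-a) → z≢0 , Sum.[ z≢a , z≢-a ] ∘ A.from)
          (λ (z≢0 , z≉±a) → z≢0 , z≉±a ∘ A.to ∘ inj₁ , z≉±a ∘ A.to ∘ inj₂)
      where module A = Equivalence (≡∨≡negᵥ⇔≈± z<n a<n)

    generates-≈± : ∀ {g} → GeneratesModSign n g → ∀ z → 0 < z → z < n → ∃[ e ] (+ g) ^ e ≈± + z
    generates-≈± {g} gen z 0<z z<n with e , powᵉ≡ ← gen z z<n (ℕ.n>0⇒n≢0 0<z) =
      e , ≈±-trans (≈⇒≈± (≈-sym power-≈)) (≡∨≡negᵥ⇔≈±-to powᵉ≡)
      where
        power-≈ : + ((g ℕ.^ e) % n) ≈ (+ g) ^ e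
        power-≈ = ≈-trans (%-≈ (g ℕ.^ e)) (≈-reflexive (pos-^ g e))
        ≡∨≡negᵥ⇔≈±-to = Equivalence.to (≡∨≡negᵥ⇔≈± (m%n<n _ n) z<n)

module PrimeModulus (p : ℕ) .{{_ : NonZero p}} (p-prime : Prime p) where
  open import Data.Integer.Base using (_+_; _-_; _*_; _^_)
  open Congruence p

  1<p : 1 < p
  1<p = ℕ.nonTrivial⇒n>1 p {{prime⇒nonTrivial p-prime}}

  1≉0 : 1ℤ ≉ 0ℤ
  1≉0 = ≉-between-0-and-n (s≤s z≤n) 1<p

  *-≈0⇒ : ∀ {a b} → a * b ≈ 0ℤ → a ≈ 0ℤ ⊎ b ≈ 0ℤ
  *-≈0⇒ {a} {b} ab≈0
    with euclidsLemma ∣ a ∣ ∣ b ∣ p-prime (subst (ℕ._∣_ p) (ℤ.abs-* a b) (∣⇒∣ᵤ (≈0⇒∣ ab≈0)))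
  ... | inj₁ p∣a = inj₁ (∣⇒≈0 (∣ᵤ⇒∣ p∣a))
  ... | inj₂ p∣b = inj₂ (∣⇒≈0 (∣ᵤ⇒∣ p∣b))

  *-≉0 : ∀ {a b} → a ≉ 0ℤ → b ≉ 0ℤ → a * b ≉ 0ℤ
  *-≉0 a≉0 b≉0 ab≈0 with *-≈0⇒ ab≈0
  ... | inj₁ a≈0 = a≉0 a≈0
  ... | inj₂ b≈0 = b≉0 b≈0

  ^-≉0 : ∀ {a} → a ≉ 0ℤ → ∀ k → a ^ k ≉ 0ℤ
  ^-≉0 a≉0 zero    = 1≉0
  ^-≉0 a≉0 (suc k) = *-≉0 a≉0 (^-≉0 a≉0 k)

  *-cancelˡ-≈ : ∀ {c a b} → c ≉ 0ℤ → c * a ≈ c * b → a ≈ b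
  *-cancelˡ-≈ {c} {a} {b} c≉0 ca≈cb
    with *-≈0⇒ (≈-trans (≈-reflexive (factor c a b)) (≈⇒-≈0 ca≈cb))
    where factor : ∀ c a b → c * (a - b) ≡ c * a - c * b
          factor = solve-∀
  ... | inj₁ c≈0   = contradiction c≈0 c≉0
  ... | inj₂ a-b≈0 = -≈0⇒≈ a-b≈0

  *-cancelˡ-≈± : ∀ {c a b} → c ≉ 0ℤ → c * a ≈± c * b → a ≈± b
  *-cancelˡ-≈± c≉0 (inj₁ ca≈cb)  = inj₁ (*-cancelˡ-≈ c≉0 ca≈cb)
  *-cancelˡ-≈± {c} {a} {b} c≉0 (inj₂ ca≈-cb) =
    inj₂ (*-cancelˡ-≈ c≉0 (≈-trans ca≈-cb (≈-reflexive (ℤ.neg-distribʳ-* c b))))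

  square-≈⇒≈± : ∀ {a b} → a * a ≈ b * b → a ≈± b
  square-≈⇒≈± {a} {b} a²≈b²
    with *-≈0⇒ (≈-trans (≈-reflexive (factor a b)) (≈⇒-≈0 a²≈b²))
    where factor : ∀ a b → (a - b) * (a - - b) ≡ a * a - b * b
          factor = solve-∀
  ... | inj₁ a-b≈0  = inj₁ (-≈0⇒≈ a-b≈0)
  ... | inj₂ a+b≈0  = inj₂ (-≈0⇒≈ a+b≈0)

  ≈±-≉0 : ∀ {a b} → a ≈± b → a ≉ 0ℤ → b ≉ 0ℤ
  ≈±-≉0 a≈±b a≉0 b≈0 = a≉0 (≈±-0⇒≈0 (≈±-trans a≈±b (≈⇒≈± b≈0)))

  module SignedPowers (m : ℕ) (p≡1+2m : p ≡ suc (2 ℕ.* m)) (ω : ℤ) (ω≉0 : ω ≉ 0ℤ)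
    (generates : ∀ z → 0 < z → z < p → ∃[ e ] ω ^ e ≈± + z) where

    m<p : m < p
    m<p = subst (m <_) (sym p≡1+2m) (s≤s (ℕ.m≤m+n m (m ℕ.+ 0)))

    p∸[1+m]≡m : p ∸ suc m ≡ m
    p∸[1+m]≡m = trans (cong (_∸ suc m) p≡1+2m)
                  (trans (ℕ.m+n∸m≡n m (m ℕ.+ 0)) (ℕ.+-identityʳ m))

    instance
      m-nonZero : NonZero m
      m-nonZero = nonZero m (subst (1 <_) p≡1+2m 1<p)
        where nonZero : ∀ k → 1 < suc (2 ℕ.* k) → NonZero k
              nonZero zero    (s≤s ())
              nonZero (suc k) _ = _

    <⇒≉± : ∀ {i j} → 0 < i → i < j → j ≤ m → ¬ (+ i ≈± + j)
    <⇒≉± {i} {j} 0<i i<j j≤m (inj₁ i≈j) = <⇒≉ i<j (ℕ.≤-<-trans j≤m m<p) i≈j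
    <⇒≉± {i} {j} 0<i i<j j≤m (inj₂ i≈-j) =
      ≉-between-0-and-n (ℕ.<-≤-trans 0<i (ℕ.m≤m+n i j)) i+j<p
        (≈-trans (≈-reflexive (trans (ℤ.pos-+ i j) (cong (λ t → + i + t) (sym (ℤ.neg-involutive (+ j))))))
                 (≈⇒-≈0 i≈-j))
      where
        i+j<p : i ℕ.+ j < p
        i+j<p = subst (i ℕ.+ j <_) (sym p≡1+2m)
                  (s≤s (ℕ.+-mono-≤ (ℕ.<⇒≤ (ℕ.<-≤-trans i<j j≤m)) (ℕ.≤-trans j≤m (ℕ.m≤m+n m 0))))

    -- Otherwise the m classes of 1, …, m would be hit by the fewer than m residues mod k
    -- of their exponents.
    no-short-period : ∀ {k} → 0 < k → k < m → ¬ (ω ^ k ≈± 1ℤ)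
    no-short-period {k} 0<k k<m ωᵏ≈±1 = collision (Fin.pigeonhole k<m residue)
      where
        instance
          k-nonZero : NonZero k
          k-nonZero = ℕ.>-nonZero 0<k
        log : (i : Fin m) → ∃[ e ] ω ^ e ≈± + suc (toℕ i)
        log i = generates (suc (toℕ i)) (s≤s z≤n) (ℕ.≤-<-trans (Fin.toℕ<n i) m<p)
        residue : Fin m → Fin k
        residue i = fromℕ< (m%n<n (proj₁ (log i)) k)
        collision : ∃₂ (λ i j → i Fin.< j × residue i ≡ residue j) → ⊥
        collision (i , j , i<j , same) = <⇒≉± (s≤s z≤n) (s≤s i<j) (Fin.toℕ<n j) (begin
          + suc (toℕ i)           ≈⟨ proj₂ (log i) ⟨
          ω ^ proj₁ (log i)       ≈⟨ ^-≈±-^-% k ωᵏ≈±1 (proj₁ (log i)) ⟩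
          ω ^ (proj₁ (log i) % k) ≡⟨ cong (ω ^_) same-residue ⟩
          ω ^ (proj₁ (log j) % k) ≈⟨ ^-≈±-^-% k ωᵏ≈±1 (proj₁ (log j)) ⟨
          ω ^ proj₁ (log j)       ≈⟨ proj₂ (log j) ⟩
          + suc (toℕ j)           ∎)
          where
            open SetoidReasoning ≈±-setoid
            same-residue : proj₁ (log i) % k ≡ proj₁ (log j) % k
            same-residue = trans (sym (Fin.toℕ-fromℕ< _)) (trans (cong toℕ same) (Fin.toℕ-fromℕ< _))

    -- z ⊓ (p ∸ z) ∈ [1, m] represents the class of ±z; pred shifts it to [0, m).
    ±class : ℕ → ℕ
    ±class z = ℕ.pred (z ⊓ (p ∸ z))

    ⊓-≈± : ∀ {z} → z ≤ p → + (z ⊓ (p ∸ z)) ≈± + z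
    ⊓-≈± {z} z≤p with ℕ.⊓-sel z (p ∸ z)
    ... | inj₁ ⊓≡z   = ≈⇒≈± (≈-reflexive (cong +_ ⊓≡z))
    ... | inj₂ ⊓≡p∸z = ≈-neg⇒≈± (≈-trans (≈-reflexive (cong +_ ⊓≡p∸z)) (n∸-≈-neg z≤p))

    ⊓-positive : ∀ {z} → 0 < z → z < p → 0 < z ⊓ (p ∸ z)
    ⊓-positive {z} 0<z z<p with ℕ.⊓-sel z (p ∸ z)
    ... | inj₁ ⊓≡z   = subst (0 <_) (sym ⊓≡z) 0<z
    ... | inj₂ ⊓≡p∸z = subst (0 <_) (sym ⊓≡p∸z) (ℕ.m<n⇒0<n∸m z<p)

    ⊓≤m : ∀ z → z ⊓ (p ∸ z) ≤ m
    ⊓≤m z with z ℕ.≤? m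
    ... | yes z≤m = ℕ.≤-trans (ℕ.m⊓n≤m z (p ∸ z)) z≤m
    ... | no  z≰m = ℕ.≤-trans (ℕ.m⊓n≤n z (p ∸ z))
                      (subst (p ∸ z ≤_) p∸[1+m]≡m (ℕ.∸-monoʳ-≤ p (ℕ.≰⇒> z≰m)))

    ±class<m : ∀ {z} → 0 < z → z < p → ±class z < m
    ±class<m {z} 0<z z<p = pred<m (⊓-positive 0<z z<p) (⊓≤m z)
      where pred<m : ∀ {x} → 0 < x → x ≤ m → ℕ.pred x < m
            pred<m {suc x} _ x<m = x<m

    ±class-≈± : ∀ {y z} → 0 < y → y < p → 0 < z → z < p → ±class y ≡ ±class z → + y ≈± + z
    ±class-≈± {y} {z} 0<y y<p 0<z z<p same = begin
      + y               ≈⟨ ⊓-≈± (ℕ.<⇒≤ y<p) ⟨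
      + (y ⊓ (p ∸ y))   ≡⟨ cong +_ (pred-injective (⊓-positive 0<y y<p) (⊓-positive 0<z z<p) same) ⟩
      + (z ⊓ (p ∸ z))   ≈⟨ ⊓-≈± (ℕ.<⇒≤ z<p) ⟩
      + z               ∎
      where
        open SetoidReasoning ≈±-setoid
        pred-injective : ∀ {a b} → 0 < a → 0 < b → ℕ.pred a ≡ ℕ.pred b → a ≡ b
        pred-injective {suc a} {suc b} _ _ = cong suc

    some-period : ∃[ d ] 0 < d × d ≤ m × ω ^ d ≈± 1ℤ
    some-period = collision (Fin.pigeonhole (ℕ.n<1+n m) class)
      where
        rep : ℕ → ℕ
        rep i = ∣ ω ^ i ∣ % p
        rep-≈± : ∀ i → + rep i ≈± ω ^ i
        rep-≈± i = ≈±-trans (≈⇒≈± (%-≈ ∣ ω ^ i ∣)) (abs-≈± (ω ^ i))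
        rep-positive : ∀ i → 0 < rep i
        rep-positive i = ℕ.n≢0⇒n>0 λ rep≡0 → ^-≉0 ω≉0 i (≈±-0⇒≈0
          (≈±-trans (≈±-sym (rep-≈± i)) (≈⇒≈± (≈-reflexive (cong +_ rep≡0)))))
        class : Fin (suc m) → Fin m
        class i = fromℕ< (±class<m (rep-positive (toℕ i)) (m%n<n _ p))
        collision : ∃₂ (λ i j → i Fin.< j × class i ≡ class j) → ∃[ d ] 0 < d × d ≤ m × ω ^ d ≈± 1ℤ
        collision (i , j , i<j , same) =
          d , ℕ.m<n⇒0<n∸m i<j , ℕ.≤-trans (ℕ.m∸n≤m b a) (ℕ.≤-pred (Fin.toℕ<n j)) ,
          ≈±-sym (*-cancelˡ-≈± (^-≉0 ω≉0 a) (begin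
            ω ^ a * 1ℤ  ≡⟨ ℤ.*-identityʳ (ω ^ a) ⟩
            ω ^ a       ≈⟨ rep-≈± a ⟨
            + rep a     ≈⟨ ±class-≈± (rep-positive a) (m%n<n _ p) (rep-positive b) (m%n<n _ p) same-class ⟩
            + rep b     ≈⟨ rep-≈± b ⟩
            ω ^ b       ≡⟨ cong (ω ^_) (ℕ.m+[n∸m]≡n (ℕ.<⇒≤ i<j)) ⟨
            ω ^ (a ℕ.+ d) ≡⟨ ℤ.^-distribˡ-+-* ω a d ⟩
            ω ^ a * ω ^ d ∎))
          where
            open SetoidReasoning ≈±-setoid
            a = toℕ i
            b = toℕ j
            d = b ∸ a
            same-class : ±class (rep a) ≡ ±class (rep b)
            same-class = trans (sym (Fin.toℕ-fromℕ< _)) (trans (cong toℕ same) (Fin.toℕ-fromℕ< _))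

    period : ω ^ m ≈± 1ℤ
    period = maximal some-period
      where
        maximal : ∃[ d ] 0 < d × d ≤ m × ω ^ d ≈± 1ℤ → ω ^ m ≈± 1ℤ
        maximal (d , 0<d , d≤m , ωᵈ≈±1) with ℕ.m≤n⇒m<n∨m≡n d≤m
        ... | inj₁ d<m = contradiction ωᵈ≈±1 (no-short-period 0<d d<m)
        ... | inj₂ d≡m = subst (λ e → ω ^ e ≈± 1ℤ) d≡m ωᵈ≈±1

    coset-complement : ∀ {γ} → ∃[ a ] ω ^ a ≈± γ → ∀ {z} → z < p →
      (∃[ k ] 0 < k × k < m × + z ≈± γ * ω ^ k) ⇔ (z ≢ 0 × ¬ (+ z ≈± γ))
    coset-complement {γ} (a , ωᵃ≈±γ) {z} z<p = mk⇔ to from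
      where
        open SetoidReasoning ≈±-setoid
        γ≉0 : γ ≉ 0ℤ
        γ≉0 = ≈±-≉0 ωᵃ≈±γ (^-≉0 ω≉0 a)

        to : ∃[ k ] 0 < k × k < m × + z ≈± γ * ω ^ k → z ≢ 0 × ¬ (+ z ≈± γ)
        to (k , 0<k , k<m , z≈±γωᵏ) = z≢0 , z≉±γ
          where
            z≢0 : z ≢ 0
            z≢0 refl = *-≉0 γ≉0 (^-≉0 ω≉0 k) (≈±-0⇒≈0 (≈±-sym z≈±γωᵏ))
            z≉±γ : ¬ (+ z ≈± γ)
            z≉±γ z≈±γ = no-short-period 0<k k<m (*-cancelˡ-≈± γ≉0 (begin
              γ * ω ^ k ≈⟨ z≈±γωᵏ ⟨
              + z       ≈⟨ z≈±γ ⟩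
              γ         ≡⟨ ℤ.*-identityʳ γ ⟨
              γ * 1ℤ    ∎))

        from : z ≢ 0 × ¬ (+ z ≈± γ) → ∃[ k ] 0 < k × k < m × + z ≈± γ * ω ^ k
        from (z≢0 , z≉±γ) with e , ωᵉ≈±z ← generates z (ℕ.n≢0⇒n>0 z≢0) z<p =
          k′ % m , ℕ.n≢0⇒n>0 k≢0 , m%n<n k′ m , z≈±γωᵏ
          where
            -- chosen so that ω^a ω^k′ = ω^e (ω^m)^a
            k′ = e ℕ.+ a ℕ.* ℕ.pred m
            exponent : a ℕ.+ k′ ≡ e ℕ.+ a ℕ.* m
            exponent = trans (identity a e (ℕ.pred m)) (cong (λ t → e ℕ.+ a ℕ.* t) (ℕ.suc-pred m))
              where identity : ∀ a e n → a ℕ.+ (e ℕ.+ a ℕ.* n) ≡ e ℕ.+ a ℕ.* suc n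
                    identity = ℕ.solve-∀
            z≈±γωᵏ : + z ≈± γ * ω ^ (k′ % m)
            z≈±γωᵏ = ≈±-sym (begin
              γ * ω ^ (k′ % m)       ≈⟨ ≈±-*-cong (≈±-sym ωᵃ≈±γ) (≈±-sym (^-≈±-^-% m period k′)) ⟩
              ω ^ a * ω ^ k′         ≡⟨ ℤ.^-distribˡ-+-* ω a k′ ⟨
              ω ^ (a ℕ.+ k′)         ≡⟨ cong (ω ^_) exponent ⟩
              ω ^ (e ℕ.+ a ℕ.* m)    ≡⟨ ℤ.^-distribˡ-+-* ω e (a ℕ.* m) ⟩
              ω ^ e * ω ^ (a ℕ.* m)  ≈⟨ ≈±-*-cong (≈±-refl {ω ^ e}) (^-multiple-≈±1 period a) ⟩
              ω ^ e * 1ℤ             ≡⟨ ℤ.*-identityʳ (ω ^ e) ⟩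
              ω ^ e                  ≈⟨ ωᵉ≈±z ⟩
              + z                    ∎)
            k≢0 : k′ % m ≢ 0
            k≢0 k≡0 = z≉±γ (≈±-trans z≈±γωᵏ (≈⇒≈± (≈-reflexive
              (trans (cong (λ t → γ * ω ^ t) k≡0) (ℤ.*-identityʳ γ)))))

  module Construction (k : ℕ) (p≡3+4k : p ≡ 3 ℕ.+ 4 ℕ.* k) (s : ℕ) (s²≈2ᴺ : + (s ℕ.* s) ≈ + 2)
    (generates : ∀ z → 0 < z → z < p → ∃[ e ] (+ suc s) ^ e ≈± + z) where

    s²≈2 : + s * + s ≈ + 2
    s²≈2 = ≈-trans (≈-reflexive (sym (ℤ.pos-* s s))) s²≈2ᴺ

    m : ℕ
    m = suc (2 ℕ.* k)

    p≡1+2m : p ≡ suc (2 ℕ.* m)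
    p≡1+2m = trans p≡3+4k (identity k)
      where identity : ∀ k → 3 ℕ.+ 4 ℕ.* k ≡ suc (2 ℕ.* suc (2 ℕ.* k))
            identity = ℕ.solve-∀

    ω : ℤ
    ω = + suc s

    ω≡1+s : ω ≡ 1ℤ + + s
    ω≡1+s = ℤ.pos-+ 1 s

    ω≉0 : ω ≉ 0ℤ
    ω≉0 ω≈0 = 1≉0 (begin
      1ℤ                     ≡⟨⟩
      + 2 - 1ℤ               ≈⟨ +-cong s²≈2 (≈-refl { - 1ℤ}) ⟨
      + s * + s - 1ℤ         ≡⟨ identity (+ s) ⟩
      (1ℤ + + s) * (+ s - 1ℤ) ≡⟨ cong (λ o → o * (+ s - 1ℤ)) ω≡1+s ⟨
      ω * (+ s - 1ℤ)         ≈⟨ *-cong ω≈0 (≈-refl {+ s - 1ℤ}) ⟩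
      0ℤ * (+ s - 1ℤ)        ≡⟨ ℤ.*-zeroˡ (+ s - 1ℤ) ⟩
      0ℤ                     ∎)
      where
        open SetoidReasoning ≈-setoid
        identity : ∀ s → s * s - 1ℤ ≡ (1ℤ + s) * (s - 1ℤ)
        identity = solve-∀

    open SignedPowers m p≡1+2m ω ω≉0 generates

    odd : ℕ → ℕ
    odd j = suc (2 ℕ.* j)

    rep : ℕ → ℕ → ℕ
    rep α e = (α ℕ.* suc s ℕ.^ e) % p

    rep-≈ : ∀ α e → + rep α e ≈ + α * ω ^ e
    rep-≈ α e = ≈-trans (%-≈ _)
      (≈-reflexive (trans (ℤ.pos-* α _) (cong (λ t → + α * t) (pos-^ (suc s) e))))

    pair : ℕ → ℕ → ℕ × ℕ
    pair α j = rep α (odd j) , rep α (suc (odd j))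

    pairs : ℕ → List (ℕ × ℕ)
    pairs α = applyUpTo (pair α) k

    sub-≈± : ∀ α e → + subᵥ p (rep α e) (rep α (suc e)) ≈± (+ α * + s) * ω ^ e
    sub-≈± α e = ≈-neg⇒≈± (begin
      + subᵥ p (rep α e) (rep α (suc e))  ≈⟨ subᵥ-≈ (rep α e) (rep α (suc e)) ⟩
      + rep α e - + rep α (suc e)         ≈⟨ +-cong (rep-≈ α e) (-‿cong (rep-≈ α (suc e))) ⟩
      A * w - A * (ω * w)                 ≡⟨ cong (λ o → A * w - A * (o * w)) ω≡1+s ⟩
      A * w - A * ((1ℤ + S) * w)          ≡⟨ identity A S w ⟩
      - ((A * S) * w)                     ∎)
      where
        open SetoidReasoning ≈-setoid
        A = + α
        S = + s
        w = ω ^ e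
        identity : ∀ a s w → a * w - a * ((1ℤ + s) * w) ≡ - ((a * s) * w)
        identity = solve-∀

    -- 1 + ω = 2 + s ≈ s + s² = s·ω since s² ≈ 2.
    add-≈± : ∀ α e → + addᵥ p (rep α e) (rep α (suc e)) ≈± (+ α * + s) * ω ^ suc e
    add-≈± α e = ≈⇒≈± (begin
      + addᵥ p (rep α e) (rep α (suc e))                  ≈⟨ addᵥ-≈ (rep α e) (rep α (suc e)) ⟩
      + rep α e + + rep α (suc e)                         ≈⟨ +-cong (rep-≈ α e) (rep-≈ α (suc e)) ⟩
      A * w + A * (ω * w)                                 ≡⟨ cong (λ o → A * w + A * (o * w)) ω≡1+s ⟩
      A * w + A * ((1ℤ + S) * w)                          ≡⟨ split A S w ⟩
      (A * S) * ((1ℤ + S) * w) + (A * w) * (+ 2 - S * S)  ≈⟨ +-cong (≈-refl {(A * S) * ((1ℤ + S) * w)})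
                                                               (*-cong (≈-refl {A * w}) (≈⇒-≈0 (≈-sym s²≈2))) ⟩
      (A * S) * ((1ℤ + S) * w) + (A * w) * 0ℤ             ≡⟨ drop ((A * S) * ((1ℤ + S) * w)) (A * w) ⟩
      (A * S) * ((1ℤ + S) * w)                            ≡⟨ cong (λ o → (A * S) * (o * w)) ω≡1+s ⟨
      (A * S) * (ω * w)                                   ∎)
      where
        open SetoidReasoning ≈-setoid
        A = + α
        S = + s
        w = ω ^ e
        split : ∀ a s w → a * w + a * ((1ℤ + s) * w) ≡ (a * s) * ((1ℤ + s) * w) + (a * w) * (+ 2 - s * s)
        split = solve-∀
        drop : ∀ x y → x + y * 0ℤ ≡ x
        drop = solve-∀

    β≈±αs : ∀ α β → + (2 ℕ.* α ℕ.* α) ≈ + (β ℕ.* β) → + β ≈± + α * + s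
    β≈±αs α β 2α²≈β² = square-≈⇒≈± (begin
      + β * + β                   ≡⟨ ℤ.pos-* β β ⟨
      + (β ℕ.* β)                 ≈⟨ 2α²≈β² ⟨
      + (2 ℕ.* α ℕ.* α)           ≡⟨ trans (ℤ.pos-* (2 ℕ.* α) α) (cong (λ t → t * + α) (ℤ.pos-* 2 α)) ⟩
      + 2 * + α * + α             ≈⟨ *-cong (*-cong (≈-sym s²≈2) (≈-refl {+ α})) (≈-refl {+ α}) ⟩
      + s * + s * + α * + α       ≡⟨ identity (+ s) (+ α) ⟩
      (+ α * + s) * (+ α * + s)   ∎)
      where
        open SetoidReasoning ≈-setoid
        identity : ∀ s a → s * s * a * a ≡ (a * s) * (a * s)
        identity = solve-∀

    covers-elem⇔ : ∀ α {z} j → z < p →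
      CoversElem p z (pair α j) ⇔ (+ z ≈± + α * ω ^ odd j ⊎ + z ≈± + α * ω ^ suc (odd j))
    covers-elem⇔ α j z<p = ⇔.trans (InPM⇔ z<p (m%n<n _ p) (m%n<n _ p))
      (≈±-respʳ (≈⇒≈± (rep-≈ α (odd j))) ⊎-⇔ ≈±-respʳ (≈⇒≈± (rep-≈ α (suc (odd j)))))

    covers-diffsum⇔ : ∀ α {γ z} → γ ≈± + α * + s → ∀ j → z < p →
      CoversDiffSum p z (pair α j) ⇔ (+ z ≈± γ * ω ^ odd j ⊎ + z ≈± γ * ω ^ suc (odd j))
    covers-diffsum⇔ α {γ} γ≈±αs j z<p = ⇔.trans (InPM⇔ z<p (m%n<n _ p) (m%n<n _ p))
      (≈±-respʳ (via {e = odd j} (sub-≈± α (odd j)))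
        ⊎-⇔ ≈±-respʳ (via {e = suc (odd j)} (add-≈± α (odd j))))
      where
        via : ∀ {x e} → x ≈± (+ α * + s) * ω ^ e → x ≈± γ * ω ^ e
        via {e = e} x≈± = ≈±-trans x≈± (≈±-*-cong (≈±-sym γ≈±αs) (≈±-refl {ω ^ e}))

    pairs-cover : ∀ α {γ} (Covers : ℕ → ℕ × ℕ → Set) → ∃[ a ] ω ^ a ≈± γ → ∀ {z} → z < p →
      (∀ j → Covers z (pair α j) ⇔ (+ z ≈± γ * ω ^ odd j ⊎ + z ≈± γ * ω ^ suc (odd j))) →
      Any (Covers z) (pairs α) ⇔ (z ≢ 0 × ¬ (+ z ≈± γ))
    pairs-cover α {γ} Covers ωᵃ≈±γ {z} z<p pair⇔ = begin
      Any (Covers z) (pairs α)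
        ≈⟨ Any-applyUpTo⇔ (pair α) k ⟩
      (∃[ j ] j < k × Covers z (pair α j))
        ≈⟨ per-index ⟩
      (∃[ j ] j < k × (+ z ≈± γ * ω ^ odd j ⊎ + z ≈± γ * ω ^ suc (odd j)))
        ≈⟨ nonzero-below-odd⇔pairs k ⟨
      (∃[ e ] 0 < e × e < m × + z ≈± γ * ω ^ e)
        ≈⟨ coset-complement ωᵃ≈±γ z<p ⟩
      (z ≢ 0 × ¬ (+ z ≈± γ))
        ∎
      where
        open SetoidReasoning (⇔.⇔-setoid 0ℓ)
        per-index : (∃[ j ] j < k × Covers z (pair α j)) ⇔
                    (∃[ j ] j < k × (+ z ≈± γ * ω ^ odd j ⊎ + z ≈± γ * ω ^ suc (odd j)))
        per-index = mk⇔ (λ (j , j<k , c) → j , j<k , Equivalence.to (pair⇔ j) c)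
                        (λ (j , j<k , c) → j , j<k , Equivalence.from (pair⇔ j) c)

    aps : ∀ {α β} → 0 < α → α < p → 0 < β → β < p → + (2 ℕ.* α ℕ.* α) ≈ + (β ℕ.* β) → APS p α β
    aps {α} {β} 0<α α<p 0<β β<p 2α²≈β² =
      pairs α ,
      trans (length-applyUpTo (pair α) k) (sym ([p∸3]/4≡k p≡3+4k)) ,
      All.applyUpTo⁺₂ (pair α) k (λ _ → m%n<n _ p , m%n<n _ p) ,
      (λ z z<p → ⇔.trans (pairs-cover α (CoversElem p) (generates α 0<α α<p) z<p (λ j → covers-elem⇔ α j z<p))
                         (⇔.sym (NotIn0PM⇔ z<p α<p))) ,
      (λ z z<p → ⇔.trans (pairs-cover α (CoversDiffSum p) (generates β 0<β β<p) z<p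
                                       (λ j → covers-diffsum⇔ α (β≈±αs α β 2α²≈β²) j z<p))
                         (⇔.sym (NotIn0PM⇔ z<p β<p)))

  module Necessity (k : ℕ) (p≡3+4k : p ≡ 3 ℕ.+ 4 ℕ.* k) (3<p : 3 < p) where

    sq : ℕ → ℤ
    sq x = + x * + x

    Σsq : List ℕ → ℤ
    Σsq xs = foldr _+_ 0ℤ (map sq xs)

    Σsq-↭ : ∀ {xs ys} → xs ↭ ys → Σsq xs ≡ Σsq ys
    Σsq-↭ xs↭ys = Permutationₛ.foldr-commMonoid (setoid ℤ) ℤ.+-0-isCommutativeMonoid (↭⇒↭ₛ (map⁺ sq xs↭ys))

    six-Σsq-downFrom : ∀ n → + 6 * Σsq (downFrom n) ≡ + n * (+ n - 1ℤ) * (+ 2 * + n - 1ℤ)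
    six-Σsq-downFrom zero    = refl
    six-Σsq-downFrom (suc n) = begin
      + 6 * (sq n + Σsq (downFrom n))
        ≡⟨ ℤ.*-distribˡ-+ (+ 6) (sq n) _ ⟩
      + 6 * sq n + + 6 * Σsq (downFrom n)
        ≡⟨ cong (λ t → + 6 * sq n + t) (six-Σsq-downFrom n) ⟩
      + 6 * sq n + + n * (+ n - 1ℤ) * (+ 2 * + n - 1ℤ)
        ≡⟨ step (+ n) ⟩
      (1ℤ + + n) * ((1ℤ + + n) - 1ℤ) * (+ 2 * (1ℤ + + n) - 1ℤ)
        ≡⟨ cong (λ N → N * (N - 1ℤ) * (+ 2 * N - 1ℤ)) (ℤ.pos-+ 1 n) ⟨
      + suc n * (+ suc n - 1ℤ) * (+ 2 * + suc n - 1ℤ)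
        ∎
      where
        open ≡-Reasoning
        step : ∀ n → + 6 * (n * n) + n * (n - 1ℤ) * (+ 2 * n - 1ℤ)
                   ≡ (1ℤ + n) * ((1ℤ + n) - 1ℤ) * (+ 2 * (1ℤ + n) - 1ℤ)
        step = solve-∀

    six-Σsq-downFrom-≈0 : + 6 * Σsq (downFrom p) ≈ 0ℤ
    six-Σsq-downFrom-≈0 = begin
      + 6 * Σsq (downFrom p)                ≡⟨ six-Σsq-downFrom p ⟩
      + p * (+ p - 1ℤ) * (+ 2 * + p - 1ℤ)   ≈⟨ *-cong (*-cong n≈0 (≈-refl {+ p - 1ℤ})) (≈-refl {+ 2 * + p - 1ℤ}) ⟩
      0ℤ * (+ p - 1ℤ) * (+ 2 * + p - 1ℤ)    ≡⟨ cong (λ t → t * (+ 2 * + p - 1ℤ)) (ℤ.*-zeroˡ (+ p - 1ℤ)) ⟩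
      0ℤ * (+ 2 * + p - 1ℤ)                 ≡⟨ ℤ.*-zeroˡ (+ 2 * + p - 1ℤ) ⟩
      0ℤ                                    ∎
      where open SetoidReasoning ≈-setoid

    2≉0 : + 2 ≉ 0ℤ
    2≉0 = ≉-between-0-and-n (s≤s z≤n) (ℕ.<-trans (ℕ.n<1+n 2) 3<p)

    Σsq-downFrom-≈0 : Σsq (downFrom p) ≈ 0ℤ
    Σsq-downFrom-≈0 with *-≈0⇒ six-Σsq-downFrom-≈0
    ... | inj₁ 6≈0 = contradiction 6≈0 (*-≉0 2≉0 (≉-between-0-and-n (s≤s z≤n) 3<p))
    ... | inj₂ Σ≈0 = Σ≈0

    sq-negᵥ : ∀ x → sq (negᵥ p x) ≈ sq x
    sq-negᵥ x = ≈-trans (*-cong (negᵥ-≈ x) (negᵥ-≈ x)) (≈-reflexive (neg-*-neg (+ x) (+ x)))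

    signedElements : List (ℕ × ℕ) → List ℕ
    signedElements []            = []
    signedElements ((x , y) ∷ S) = x ∷ negᵥ p x ∷ y ∷ negᵥ p y ∷ signedElements S

    length-signedElements : ∀ S → length (signedElements S) ≡ 4 ℕ.* length S
    length-signedElements []      = refl
    length-signedElements (_ ∷ S) =
      trans (cong (λ l → 4 ℕ.+ l) (length-signedElements S)) (sym (ℕ.*-suc 4 (length S)))

    covered⇒∈ : ∀ {z} S → Any (CoversElem p z) S → z ∈ signedElements S
    covered⇒∈ (_ ∷ _) (here (inj₁ z≡x))                 = here z≡x
    covered⇒∈ (_ ∷ _) (here (inj₂ (inj₁ z≡-x)))         = there (here z≡-x)
    covered⇒∈ (_ ∷ _) (here (inj₂ (inj₂ (inj₁ z≡y))))   = there (there (here z≡y))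
    covered⇒∈ (_ ∷ _) (here (inj₂ (inj₂ (inj₂ z≡-y))))  = there (there (there (here z≡-y)))
    covered⇒∈ (_ ∷ S) (there covered)                   = there (there (there (there (covered⇒∈ S covered))))

    Σpair : List (ℕ × ℕ) → ℤ
    Σpair []            = 0ℤ
    Σpair ((x , y) ∷ S) = sq x + sq y + Σpair S

    Σsq-signedElements : ∀ S → Σsq (signedElements S) ≈ + 2 * Σpair S
    Σsq-signedElements []            = ≈-refl
    Σsq-signedElements ((x , y) ∷ S) = begin
      sq x + (sq (negᵥ p x) + (sq y + (sq (negᵥ p y) + Σsq (signedElements S))))
        ≈⟨ +-cong (≈-refl {sq x}) (+-cong (sq-negᵥ x)
             (+-cong (≈-refl {sq y}) (+-cong (sq-negᵥ y) (Σsq-signedElements S)))) ⟩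
      sq x + (sq x + (sq y + (sq y + + 2 * Σpair S)))
        ≡⟨ identity (sq x) (sq y) (Σpair S) ⟩
      + 2 * (sq x + sq y + Σpair S) ∎
      where
        open SetoidReasoning ≈-setoid
        identity : ∀ a b c → a + (a + (b + (b + + 2 * c))) ≡ + 2 * (a + b + c)
        identity = solve-∀

    diffSum : ℕ × ℕ → ℕ × ℕ
    diffSum (x , y) = subᵥ p x y , addᵥ p x y

    Σpair-diffSum : ∀ S → Σpair (map diffSum S) ≈ + 2 * Σpair S
    Σpair-diffSum []            = ≈-refl
    Σpair-diffSum ((x , y) ∷ S) = begin
      sq (subᵥ p x y) + sq (addᵥ p x y) + Σpair (map diffSum S)
        ≈⟨ +-cong (+-cong (*-cong (subᵥ-≈ x y) (subᵥ-≈ x y)) (*-cong (addᵥ-≈ x y) (addᵥ-≈ x y)))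
                  (Σpair-diffSum S) ⟩
      (+ x - + y) * (+ x - + y) + (+ x + + y) * (+ x + + y) + + 2 * Σpair S
        ≡⟨ parallelogram (+ x) (+ y) (Σpair S) ⟩
      + 2 * (sq x + sq y + Σpair S) ∎
      where
        open SetoidReasoning ≈-setoid
        parallelogram : ∀ a b c → (a - b) * (a - b) + (a + b) * (a + b) + + 2 * c ≡ + 2 * (a * a + b * b + c)
        parallelogram = solve-∀

    Σpair-≈ : ∀ {α} S → 4 ℕ.* length S ≡ p ∸ 3 →
      (∀ z → z < p → NotIn0PM p α z → Any (CoversElem p z) S) → + 2 * Σpair S ≈ - (+ 2 * sq α)
    Σpair-≈ {α} S 4|S|≡p-3 cover = begin
      + 2 * Σpair S
        ≈⟨ Σsq-signedElements S ⟨
      Σsq (signedElements S)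
        ≡⟨ isolate (sq α) (sq (negᵥ p α)) (Σsq (signedElements S)) ⟩
      Σsq (0 ∷ α ∷ negᵥ p α ∷ signedElements S) - (sq α + sq (negᵥ p α))
        ≡⟨ cong (λ t → t - (sq α + sq (negᵥ p α))) (Σsq-↭ complete) ⟩
      Σsq (downFrom p) - (sq α + sq (negᵥ p α))
        ≈⟨ +-cong Σsq-downFrom-≈0 (-‿cong (+-cong (≈-refl {sq α}) (sq-negᵥ α))) ⟩
      0ℤ - (sq α + sq α)
        ≡⟨ double (sq α) ⟩
      - (+ 2 * sq α)
        ∎
      where
        open SetoidReasoning ≈-setoid
        isolate : ∀ a b x → x ≡ (0ℤ + (a + (b + x))) - (a + b)
        isolate = solve-∀
        double : ∀ a → 0ℤ - (a + a) ≡ - (+ 2 * a)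
        double = solve-∀
        covers : ∀ {z} → z ∈ downFrom p → z ∈ 0 ∷ α ∷ negᵥ p α ∷ signedElements S
        covers {z} z∈ with z ℕ.≟ 0 | z ℕ.≟ α | z ℕ.≟ negᵥ p α
        ... | yes z≡0 | _       | _        = here z≡0
        ... | no _    | yes z≡α | _        = there (here z≡α)
        ... | no _    | no _    | yes z≡-α = there (there (here z≡-α))
        ... | no z≢0  | no z≢α  | no z≢-α  =
          there (there (there (covered⇒∈ S (cover z (∈-downFrom⁻ z∈) (z≢0 , z≢α , z≢-α)))))
        short : length (0 ∷ α ∷ negᵥ p α ∷ signedElements S) ≤ length (downFrom p)
        short = ℕ.≤-reflexive (trans (cong (λ l → 3 ℕ.+ l) (trans (length-signedElements S) 4|S|≡p-3))
                              (trans (ℕ.m+[n∸m]≡n (ℕ.<⇒≤ 3<p)) (sym (length-downFrom p))))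
        complete : 0 ∷ α ∷ negᵥ p α ∷ signedElements S ↭ downFrom p
        complete = ⊆-shorter⇒↭ (downFrom⁺ p) covers short

    aps⇒ : ∀ {α β} → APS p α β → + (2 ℕ.* α ℕ.* α) ≈ + (β ℕ.* β)
    aps⇒ {α} {β} (S , |S|≡[p∸3]/4 , _ , elements , diffSums) = begin
      + (2 ℕ.* α ℕ.* α)  ≡⟨ trans (ℤ.pos-* (2 ℕ.* α) α)
                              (trans (cong (λ t → t * + α) (ℤ.pos-* 2 α)) (ℤ.*-assoc (+ 2) (+ α) (+ α))) ⟩
      + 2 * sq α         ≈⟨ *-cancelˡ-≈ 2≉0 doubled ⟩
      sq β               ≡⟨ ℤ.pos-* β β ⟨
      + (β ℕ.* β)        ∎
      where
        open SetoidReasoning ≈-setoid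
        4|S|≡p∸3 : 4 ℕ.* length S ≡ p ∸ 3
        4|S|≡p∸3 = trans (cong (λ l → 4 ℕ.* l) (trans |S|≡[p∸3]/4 ([p∸3]/4≡k {k = k} p≡3+4k))) (sym p∸3≡4k)
          where p∸3≡4k : p ∸ 3 ≡ 4 ℕ.* k
                p∸3≡4k = cong (_∸ 3) p≡3+4k
        elements≈ : + 2 * Σpair S ≈ - (+ 2 * sq α)
        elements≈ = Σpair-≈ S 4|S|≡p∸3 (λ z z<p → Equivalence.from (elements z z<p))
        diffSums≈ : + 2 * Σpair (map diffSum S) ≈ - (+ 2 * sq β)
        diffSums≈ = Σpair-≈ (map diffSum S) (trans (cong (λ l → 4 ℕ.* l) (length-map diffSum S)) 4|S|≡p∸3)
                      (λ z z<p → Any.map⁺ ∘ Equivalence.from (diffSums z z<p))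
        doubled : + 2 * (+ 2 * sq α) ≈ + 2 * sq β
        doubled = begin
          + 2 * (+ 2 * sq α)               ≡⟨ identity (sq α) ⟩
          - (+ 2 * - (+ 2 * sq α))         ≈⟨ -‿cong (*-cong (≈-refl {+ 2}) elements≈) ⟨
          - (+ 2 * (+ 2 * Σpair S))        ≈⟨ -‿cong (*-cong (≈-refl {+ 2}) (Σpair-diffSum S)) ⟨
          - (+ 2 * Σpair (map diffSum S))  ≈⟨ -‿cong diffSums≈ ⟩
          - - (+ 2 * sq β)                 ≡⟨ ℤ.neg-involutive (+ 2 * sq β) ⟩
          + 2 * sq β                       ∎
          where identity : ∀ a → + 2 * (+ 2 * a) ≡ - (+ 2 * - (+ 2 * a))
                identity = solve-∀

open import Data.Nat.Base using (_+_; _*_)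

theorem4p5 : (p : ℕ) → .{{_ : NonZero p}} → Prime p → p % 8 ≡ 7
    → (s : ℕ) → s < p → (s * s) % p ≡ 2 % p
    → GeneratesModSign p (1 + s)
    → (α β : ℕ) → 0 < α → α < p → 0 < β → β < p
    → (APS p α β ⇔ (2 * α * α) % p ≡ (β * β) % p)
theorem4p5 p p-prime p%8≡7 s _ s²≡2 generates α β 0<α α<p 0<β β<p =
  ⇔.trans (mk⇔ (Necessity.aps⇒ k p≡3+4k 3<p)
                (Construction.aps k p≡3+4k s (to (%≡⇔≈ (s * s) 2) s²≡2) (generates-≈± generates)
                                  0<α α<p 0<β β<p))
          (⇔.sym (%≡⇔≈ (2 * α * α) (β * β)))
  where
    open Congruence p
    open PrimeModulus p p-prime
    open Equivalence using (to)
    k = suc (2 * (p / 8))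
    p≡3+4k : p ≡ 3 + 4 * k
    p≡3+4k = ≡7-mod-8⇒≡3+4k p%8≡7
    3<p : 3 < p
    3<p = subst (3 <_) (sym p≡3+4k) (s≤s (s≤s (s≤s (s≤s z≤n))))
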